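{- Let $G=(V,E)$ be an atomic bispanning graph, $v$ a vertex of degree $3$ with neighbours $x,y,z$ and incident edges $e_x,e_y,e_z$, let $\{a,b,c\}=\{x,y,z\}$, and let $G_{a,b}$ be $G-v$ plus a new edge $e_{a,b}$ joining $a$ and $b$. If $(f,e_{a,b},S,T)$ is an arc of $\vec{\tau}_3(G_{a,b})$, then there is $e_2\in\{e_a,e_b\}$ such that (i) $(f,e_2,\rho_{e_{a,b},c}(S,T))$ is an arc of $\vec{\tau}_3(G)$, and (ii) $(e_2,f,S',T')$ is an arc of $\vec{\tau}_3(G)$, where $(S',T')$ is the head of the arc in (i).
   Context: Graphs are finite, undirected, may have parallel edges, no loops; bispanning means the edge set is the disjoint union of two spanning trees; atomic means no subgraph other than $G$ and $K_1$ is bispanning. $G_{a,b}$ is bispanning with edge set $E\setminus\{e_x,e_y,e_z\}$ plus $e_{a,b}$. $\rho_{e_{a,b},c}(S,T)=(S-e_{a,b}+e_a+e_b,T+e_c)$ if $e_{a,b}\in S$ and $(S+e_c,T-e_{a,b}+e_a+e_b)$ if $e_{a,b}\in T$. For a spanning tree $T$ and $e\notin T$, $C_H(T,e)$ is the unique cycle in $T+e$; for a spanning tree $S$ and $e\in S$, $D_H(S,e)$ is the set of edges joining the two components of $S-e$. For a bispanning $H$, $\vec{\tau}_3(H)$ has as vertices the ordered pairs $(S,T)$ of disjoint spanning trees covering $E(H)$, an arc $(e,f,S,T)$ from $(S,T)$ to $(S-e+f,T+e-f)$ when $(e,f)\in S\times T$ and $D_H(S,e)\cap C_H(T,e)=\{e,f\}$,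 and an arc $(e,f,S,T)$ from $(S,T)$ to $(S+e-f,T-e+f)$ when $(e,f)\in T\times S$ and $D_H(T,e)\cap C_H(S,e)=\{e,f\}$. -}

module Defs where

open import Data.Nat using (ℕ)
open import Data.Fin using (Fin)
open import Data.Fin.Properties using () renaming (_≟_ to _≟F_)
open import Data.Bool using (Bool; true; false; not; _∧_; _∨_; if_then_else_)
open import Data.Product using (Σ; _×_; _,_; proj₁; proj₂)
open import Data.Sum using (_⊎_; inj₁; inj₂)
open import Data.Sum.Properties using (≡-dec)
open import Data.Unit using (⊤; tt)
open import Data.Unit.Properties using () renaming (_≟_ to _≟⊤_)
open import Relation.Nullary using (¬_; ⌊_⌋)
open import Relation.Binary.Definitions using (DecidableEquality)
open import Relation.Binary.PropositionalEquality using (_≡_; _≢_)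
open import Function.Bundles using (_⇔_)

_∈ₛ_ : {E : Set} → E → (E → Bool) → Set
e ∈ₛ S = S e ≡ true

-- Everything below is relative to an ambient multigraph: vertices Fin n,
-- edges of type E (decidable equality), and an endpoint map.

record Sub (n : ℕ) (E : Set) : Set where
  constructor mkSub
  field
    vs : Fin n → Bool
    es : E → Bool
open Sub public

module Ambient {n : ℕ} {E : Set} (_≟_ : DecidableEquality E)
               (ends : E → Fin n × Fin n) where

  del : (E → Bool) → E → (E → Bool)
  del F e g = F g ∧ not ⌊ g ≟ e ⌋

  add : (E → Bool) → E → (E → Bool)
  add F e g = F g ∨ ⌊ g ≟ e ⌋

  data Reach (F : E → Bool) (u : Fin n) : Fin n → Set where
    here : Reach F u u
    fwd  : ∀ {w} g → Reach F u w → g ∈ₛ F → proj₁ (ends g) ≡ w →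
           Reach F u (proj₂ (ends g))
    bwd  : ∀ {w} g → Reach F u w → g ∈ₛ F → proj₂ (ends g) ≡ w →
           Reach F u (proj₁ (ends g))

  _⊆ₛ_ : (E → Bool) → (E → Bool) → Set
  F ⊆ₛ F' = ∀ e → e ∈ₛ F → e ∈ₛ F'

  -- a spanning tree of H: edges of H, connecting all vertices of H,
  -- and acyclic (every edge of T is a bridge of T)
  IsSpanningTree : Sub n E → (E → Bool) → Set
  IsSpanningTree H T =
    (T ⊆ₛ es H)
    × (∀ u w → u ∈ₛ vs H → w ∈ₛ vs H → Reach T u w)
    × (∀ g → g ∈ₛ T → ¬ Reach (del T g) (proj₁ (ends g)) (proj₂ (ends g)))

  -- vertices of τ₃(H): ordered pairs of disjoint spanning trees covering E(H)
  IsTreePair : Sub n E → (E → Bool) → (E → Bool) → Set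
  IsTreePair H S T =
    IsSpanningTree H S × IsSpanningTree H T
    × (∀ e → e ∈ₛ S → e ∈ₛ T → ⊥')
    × (∀ e → e ∈ₛ es H → (S e ∨ T e) ≡ true)
    where open import Data.Empty renaming (⊥ to ⊥')

  Bispanning : Sub n E → Set
  Bispanning H = Σ (E → Bool) λ S → Σ (E → Bool) λ T → IsTreePair H S T

  -- D_H(S,e): edges of H joining the two components of S - e
  InD : Sub n E → (E → Bool) → E → E → Set
  InD H S e g = g ∈ₛ es H × ¬ Reach (del S e) (proj₁ (ends g)) (proj₂ (ends g))

  -- C_H(T,e): the unique cycle of T + e, i.e. e together with the edges of
  -- the T-path between the endpoints of e (those g ∈ T whose removal
  -- separates the endpoints of e)
  InC : (E → Bool) → E → E → Set
  InC T e g = g ≡ e ⊎ (g ∈ₛ T × ¬ Reach (del T g) (proj₁ (ends e)) (proj₂ (ends e)))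

  Exch : Sub n E → (E → Bool) → (E → Bool) → E → E → Set
  Exch H S T e f = ∀ g → (InD H S e g × InC T e g) ⇔ (g ≡ e ⊎ g ≡ f)

  IsArc : Sub n E → E → E → (E → Bool) → (E → Bool) → Set
  IsArc H e f S T =
    IsTreePair H S T
    × ((e ∈ₛ S × f ∈ₛ T × Exch H S T e f)
       ⊎ (e ∈ₛ T × f ∈ₛ S × Exch H T S e f))

  arcHead : E → E → (E → Bool) → (E → Bool) → (E → Bool) × (E → Bool)
  arcHead e f S T =
    if S e then (add (del S e) f , del (add T e) f)
           else (del (add S e) f , add (del T e) f)

  IsSubgraph : Sub n E → Sub n E → Set
  IsSubgraph H G =
    (vs H ⊆ᵥ vs G) × (es H ⊆ₛ es G)
    × (∀ e → e ∈ₛ es H → proj₁ (ends e) ∈ₛ vs H × proj₂ (ends e) ∈ₛ vs H)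
    × Σ (Fin n) (λ u → u ∈ₛ vs H)
    where
      _⊆ᵥ_ : (Fin n → Bool) → (Fin n → Bool) → Set
      A ⊆ᵥ B = ∀ u → u ∈ₛ A → u ∈ₛ B

  Atomic : Sub n E → Set
  Atomic G = ∀ H → IsSubgraph H G → Bispanning H →
    ((∀ u → vs H u ≡ vs G u) × (∀ e → es H e ≡ es G e))
    ⊎ Σ (Fin n) (λ u → ∀ w → (w ∈ₛ vs H) ⇔ (w ≡ u))

full : {n m : ℕ} → Sub n (Fin m)
full = mkSub (λ _ → true) (λ _ → true)

Loopless : {n m : ℕ} → (Fin m → Fin n × Fin n) → Set
Loopless ends = ∀ e → proj₁ (ends e) ≢ proj₂ (ends e)

Joins : {n m : ℕ} → (Fin m → Fin n × Fin n) → Fin m → Fin n → Fin n → Set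
Joins ends e u w = ends e ≡ (u , w) ⊎ ends e ≡ (w , u)

-- edges of G_{a,b}: old edges inj₁ e, and the new edge e_{a,b} = inj₂ tt
EdAB : ℕ → Set
EdAB m = Fin m ⊎ ⊤

_≟AB_ : {m : ℕ} → DecidableEquality (EdAB m)
_≟AB_ = ≡-dec _≟F_ _≟⊤_

eab : {m : ℕ} → EdAB m
eab = inj₂ tt

endsAB : {n m : ℕ} → (Fin m → Fin n × Fin n) → Fin n → Fin n →
         EdAB m → Fin n × Fin n
endsAB ends a b (inj₁ e) = ends e
endsAB ends a b (inj₂ _) = (a , b)

-- G_{a,b} = G - v + e_{a,b}, as a subgraph of the ambient on Fin n, EdAB m
G-ab : {n m : ℕ} → Fin n → Fin m → Fin m → Fin m → Sub n (EdAB m)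
G-ab v ea eb ec = mkSub
  (λ u → not ⌊ u ≟F v ⌋)
  (λ { (inj₁ e) → not (⌊ e ≟F ea ⌋ ∨ ⌊ e ≟F eb ⌋ ∨ ⌊ e ≟F ec ⌋)
     ; (inj₂ _) → true })

-- ρ_{e_{a,b},c}(S,T), with the edges of G - v identified with those of G
ρ : {m : ℕ} → Fin m → Fin m → Fin m → (EdAB m → Bool) → (EdAB m → Bool) →
    (Fin m → Bool) × (Fin m → Bool)
ρ ea eb ec S T =
  if S eab
  then ((λ e → S (inj₁ e) ∨ ⌊ e ≟F ea ⌋ ∨ ⌊ e ≟F eb ⌋) ,
        (λ e → T (inj₁ e) ∨ ⌊ e ≟F ec ⌋))
  else ((λ e → S (inj₁ e) ∨ ⌊ e ≟F ec ⌋) ,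
        (λ e → T (inj₁ e) ∨ ⌊ e ≟F ea ⌋ ∨ ⌊ e ≟F eb ⌋))

{-# OPTIONS --safe #-}
-- Let P be the tree of (S,T) containing f and Q the one containing e_ab, so that ρ turns them
-- into P + e_c and Q - e_ab + e_a + e_b, which are again spanning trees of G. Walks of G_ab lift to
-- G by replacing e_ab with e_a e_b, and walks of G collapse to G_ab by identifying v with a
-- suitable neighbour; through these two maps the fundamental cut and cycle of f in G are read off
-- from those in G_ab. Since e_ab lies in D(P,f), the vertices a and b are in
-- different components of P - f, and e₂ is the spoke towards whichever of a, b is not in the
-- component of c. Part (ii) holds in any graph: the reverse of an arc of τ₃ is an arc leaving its head.
module Submission where

open import Defs
open import Data.Nat using (ℕ)
open import Data.Fin using (Fin)
open import Data.Fin.Properties using () renaming (_≟_ to _≟F_)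
open import Data.Bool using (Bool; true; false; _∨_; if_then_else_)
open import Data.Bool.Properties using (∨-comm; ∨-zeroʳ; ¬-not)
open import Data.Product using (Σ; _×_; _,_; proj₁; proj₂)
open import Data.Sum using (_⊎_; inj₁; inj₂; [_,_]′; swap)
open import Data.Empty using (⊥; ⊥-elim)
open import Relation.Nullary using (¬_; yes; no; ⌊_⌋; Dec)
open import Relation.Binary.Definitions using (DecidableEquality)
open import Relation.Binary.PropositionalEquality
  using (_≡_; _≢_; refl; sym; trans; cong; subst₂; ≢-sym)
open import Function.Bundles using (mk⇔; Equivalence)

∨-introˡ : ∀ {x y} → x ≡ true → x ∨ y ≡ true
∨-introˡ refl = refl

∨-introʳ : ∀ {x y} → y ≡ true → x ∨ y ≡ true
∨-introʳ {x} refl = ∨-zeroʳ x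

∨-elim : ∀ x {y} → x ∨ y ≡ true → x ≡ true ⊎ y ≡ true
∨-elim true  _ = inj₁ refl
∨-elim false p = inj₂ p

⌊⌋-yes : ∀ {P : Set} (d : Dec P) → P → ⌊ d ⌋ ≡ true
⌊⌋-yes (yes _) _ = refl
⌊⌋-yes (no ¬p) p = ⊥-elim (¬p p)

⌊⌋-no : ∀ {P : Set} (d : Dec P) → ¬ P → ⌊ d ⌋ ≡ false
⌊⌋-no (yes p) ¬p = ⊥-elim (¬p p)
⌊⌋-no (no _)  _  = refl

⌊⌋-yes⁻¹ : ∀ {P : Set} (d : Dec P) → ⌊ d ⌋ ≡ true → P
⌊⌋-yes⁻¹ (yes p) _ = p

module ReachProperties {n : ℕ} {E : Set} (_≟_ : DecidableEquality E)
                       (ends : E → Fin n × Fin n) where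
  open Ambient _≟_ ends

  Connects : (E → Bool) → E → Set
  Connects F g = Reach F (proj₁ (ends g)) (proj₂ (ends g))

  ∈-del⁺ : ∀ {F g h} → h ∈ₛ F → h ≢ g → h ∈ₛ del F g
  ∈-del⁺ {F} {g} {h} p h≢g rewrite p | ⌊⌋-no (h ≟ g) h≢g = refl

  ∈-del⁻ : ∀ {F g h} → h ∈ₛ del F g → h ∈ₛ F × h ≢ g
  ∈-del⁻ {F} {g} {h} p with F h | h ≟ g
  ∈-del⁻ p  | true  | no h≢g = refl , h≢g
  ∈-del⁻ () | true  | yes _
  ∈-del⁻ () | false | _

  ∈-addˡ : ∀ {F x h} → h ∈ₛ F → h ∈ₛ add F x
  ∈-addˡ = ∨-introˡ

  ∈-add-self : ∀ {F x} → x ∈ₛ add F x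
  ∈-add-self {F} {x} = ∨-introʳ {F x} (⌊⌋-yes (x ≟ x) refl)

  ∈-add⁻ : ∀ {F x h} → h ∈ₛ add F x → h ∈ₛ F ⊎ h ≡ x
  ∈-add⁻ {F} {x} {h} p with ∨-elim (F h) p
  ... | inj₁ h∈F = inj₁ h∈F
  ... | inj₂ h≡x = inj₂ (⌊⌋-yes⁻¹ (h ≟ x) h≡x)

  Reach-trans : ∀ {F u w x} → Reach F u w → Reach F w x → Reach F u x
  Reach-trans r here               = r
  Reach-trans r (fwd g r' g∈F eq)  = fwd g (Reach-trans r r') g∈F eq
  Reach-trans r (bwd g r' g∈F eq)  = bwd g (Reach-trans r r') g∈F eq

  Reach-edge : ∀ {F} g → g ∈ₛ F → Connects F g
  Reach-edge g g∈F = fwd g here g∈F refl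

  Reach-sym : ∀ {F u w} → Reach F u w → Reach F w u
  Reach-sym here                = here
  Reach-sym (fwd g r g∈F refl)  = Reach-trans (bwd g here g∈F refl) (Reach-sym r)
  Reach-sym (bwd g r g∈F refl)  = Reach-trans (Reach-edge g g∈F) (Reach-sym r)

  Reach-image : ∀ {E₀ : Set} {_≟₀_ : DecidableEquality E₀} {ends₀ : E₀ → Fin n × Fin n}
    (π : Fin n → Fin n) {F₀ F u w} →
    (∀ g → g ∈ₛ F₀ → Reach F (π (proj₁ (ends₀ g))) (π (proj₂ (ends₀ g)))) →
    Ambient.Reach _≟₀_ ends₀ F₀ u w → Reach F (π u) (π w)
  Reach-image π h Ambient.here               = here
  Reach-image π h (Ambient.fwd g r g∈F refl) = Reach-trans (Reach-image π h r) (h g g∈F)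
  Reach-image π h (Ambient.bwd g r g∈F refl) = Reach-trans (Reach-image π h r) (Reach-sym (h g g∈F))

  Reach-map : ∀ {F F' u w} → (∀ g → g ∈ₛ F → Connects F' g) → Reach F u w → Reach F' u w
  Reach-map = Reach-image (λ u → u)

  Reach-mono : ∀ {F F' u w} → F ⊆ₛ F' → Reach F u w → Reach F' u w
  Reach-mono F⊆F' = Reach-map (λ g g∈F → Reach-edge g (F⊆F' g g∈F))

  Reach-isolated : ∀ {F u x} → (∀ g → g ∈ₛ F → proj₁ (ends g) ≢ x × proj₂ (ends g) ≢ x) →
                   Reach F u x → u ≡ x
  Reach-isolated avoid here               = refl
  Reach-isolated avoid (fwd g _ g∈F refl) = ⊥-elim (proj₂ (avoid g g∈F) refl)
  Reach-isolated avoid (bwd g _ g∈F refl) = ⊥-elim (proj₁ (avoid g g∈F) refl)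

  Endpoint : E → Fin n → Set
  Endpoint h z = z ≡ proj₁ (ends h) ⊎ z ≡ proj₂ (ends h)

  Through : (E → Bool) → E → Fin n → Fin n → Set
  Through F h u w = Σ (Fin n) λ z → Σ (Fin n) λ z' →
    Endpoint h z × Endpoint h z' × Reach (del F h) u z × Reach (del F h) z' w

  Through-last : ∀ {F h u w w'} → Reach (del F h) u w ⊎ Through F h u w →
                 Endpoint h w → Endpoint h w' → Through F h u w'
  Through-last (inj₁ r) ew ew' = _ , _ , ew , ew' , r , here
  Through-last (inj₂ (z , _ , ez , _ , r₁ , _)) _ ew' = z , _ , ez , ew' , r₁ , here

  Through-extend : ∀ {F h u w w'} → (∀ {x} → Reach (del F h) x w → Reach (del F h) x w') →
                   Reach (del F h) u w ⊎ Through F h u w → Reach (del F h) u w' ⊎ Through F h u w'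
  Through-extend k (inj₁ r) = inj₁ (k r)
  Through-extend k (inj₂ (z , z' , ez , ez' , r₁ , r₂)) = inj₂ (z , z' , ez , ez' , r₁ , k r₂)

  Reach-del-split : ∀ {F u w} h → Reach F u w → Reach (del F h) u w ⊎ Through F h u w
  Reach-del-split h here = inj₁ here
  Reach-del-split {F} h (fwd g r g∈F refl) with g ≟ h
  ... | yes refl = inj₂ (Through-last (Reach-del-split h r) (inj₁ refl) (inj₂ refl))
  ... | no g≢h   = Through-extend (λ r' → fwd g r' (∈-del⁺ {F} g∈F g≢h) refl) (Reach-del-split h r)
  Reach-del-split {F} h (bwd g r g∈F refl) with g ≟ h
  ... | yes refl = inj₂ (Through-last (Reach-del-split h r) (inj₂ refl) (inj₁ refl))
  ... | no g≢h   = Through-extend (λ r' → bwd g r' (∈-del⁺ {F} g∈F g≢h) refl) (Reach-del-split h r)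

  Reach-del-side : ∀ {F u} h → Reach F (proj₁ (ends h)) u →
    Reach (del F h) u (proj₁ (ends h)) ⊎ Reach (del F h) u (proj₂ (ends h))
  Reach-del-side h r with Reach-del-split h r
  ... | inj₁ r' = inj₁ (Reach-sym r')
  ... | inj₂ (_ , _ , _ , inj₁ refl , _ , r₂) = inj₁ (Reach-sym r₂)
  ... | inj₂ (_ , _ , _ , inj₂ refl , _ , r₂) = inj₂ (Reach-sym r₂)

  Connects-exchange : ∀ {F F'} x y → Connects F x → ¬ Connects (del F y) x →
                      del F y ⊆ₛ F' → x ∈ₛ F' → Connects F' y
  Connects-exchange x y r ¬r F-y⊆F' x∈F' with Reach-del-split y r
  ... | inj₁ r' = ⊥-elim (¬r r')
  ... | inj₂ (_ , _ , inj₁ refl , inj₁ refl , r₁ , r₂) = ⊥-elim (¬r (Reach-trans r₁ r₂))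
  ... | inj₂ (_ , _ , inj₂ refl , inj₂ refl , r₁ , r₂) = ⊥-elim (¬r (Reach-trans r₁ r₂))
  ... | inj₂ (_ , _ , inj₁ refl , inj₂ refl , r₁ , r₂) =
    Reach-trans (Reach-sym (Reach-mono F-y⊆F' r₁))
      (Reach-trans (Reach-edge x x∈F') (Reach-sym (Reach-mono F-y⊆F' r₂)))
  ... | inj₂ (_ , _ , inj₂ refl , inj₁ refl , r₁ , r₂) =
    Reach-trans (Reach-mono F-y⊆F' r₂)
      (Reach-trans (Reach-sym (Reach-edge x x∈F')) (Reach-mono F-y⊆F' r₁))

  IsTreePair-swap : ∀ {H S T} → IsTreePair H S T → IsTreePair H T S
  IsTreePair-swap {S = S} {T} (treeS , treeT , disjoint , cover) =
    treeT , treeS , (λ e e∈T e∈S → disjoint e e∈S e∈T) ,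
    λ e e∈H → trans (∨-comm (T e) (S e)) (cover e e∈H)

module TreeExchange {n : ℕ} {E : Set} (_≟_ : DecidableEquality E) (ends : E → Fin n × Fin n)
  (H : Sub n E)
  (closed : ∀ e → e ∈ₛ es H → proj₁ (ends e) ∈ₛ vs H × proj₂ (ends e) ∈ₛ vs H) where
  open Ambient _≟_ ends
  open ReachProperties _≟_ ends

  -- X* is X - x + y, up to extensional equality of edge sets.
  record Exchanged (X : E → Bool) (x y : E) (X* : E → Bool) : Set where
    field
      added     : y ∈ₛ X*
      removed   : ¬ x ∈ₛ X*
      kept      : ∀ h → h ∈ₛ X → h ≢ x → h ∈ₛ X*
      no-others : ∀ h → h ∈ₛ X* → h ≢ y → h ∈ₛ X

  add-del-Exchanged : ∀ {X x y} → x ≢ y → Exchanged X x y (add (del X x) y)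
  add-del-Exchanged {X} {x} {y} x≢y = record
    { added     = ∈-add-self {del X x}
    ; removed   = λ x∈X* →
        [ (λ x∈X-x → proj₂ (∈-del⁻ {X} x∈X-x) refl) , x≢y ]′ (∈-add⁻ {del X x} x∈X*)
    ; kept      = λ h h∈X h≢x → ∈-addˡ {del X x} (∈-del⁺ {X} h∈X h≢x)
    ; no-others = λ h h∈X* h≢y →
        [ (λ h∈X-x → proj₁ (∈-del⁻ {X} h∈X-x)) , (λ h≡y → ⊥-elim (h≢y h≡y)) ]′
          (∈-add⁻ {del X x} h∈X*)
    }

  del-add-Exchanged : ∀ {X x y} → y ≢ x → Exchanged X x y (del (add X y) x)
  del-add-Exchanged {X} {x} {y} y≢x = record
    { added     = ∈-del⁺ {add X y} (∈-add-self {X}) y≢x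
    ; removed   = λ x∈X* → proj₂ (∈-del⁻ {add X y} x∈X*) refl
    ; kept      = λ h h∈X h≢x → ∈-del⁺ {add X y} (∈-addˡ {X} h∈X) h≢x
    ; no-others = λ h h∈X* h≢y →
        [ (λ h∈X → h∈X) , (λ h≡y → ⊥-elim (h≢y h≡y)) ]′
          (∈-add⁻ {X} (proj₁ (∈-del⁻ {add X y} h∈X*)))
    }

  module _ {X X* x y} (ex : Exchanged X x y X*) where
    open Exchanged ex

    Exchanged-⊇ : del X x ⊆ₛ X*
    Exchanged-⊇ h h∈X-x = let (h∈X , h≢x) = ∈-del⁻ {X} h∈X-x in kept h h∈X h≢x

    Exchanged-del-⊆ : del X* y ⊆ₛ del X x
    Exchanged-del-⊆ h h∈X*-y = let (h∈X* , h≢y) = ∈-del⁻ {X*} h∈X*-y in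
      ∈-del⁺ {X} (no-others h h∈X* h≢y) λ { refl → removed h∈X* }

    Exchanged-del-⊇ : ¬ y ∈ₛ X → del X x ⊆ₛ del X* y
    Exchanged-del-⊇ y∉X h h∈X-x = let (h∈X , h≢x) = ∈-del⁻ {X} h∈X-x in
      ∈-del⁺ {X*} (kept h h∈X h≢x) λ { refl → y∉X h∈X }

    IsSpanningTree-exchange : IsSpanningTree H X → x ∈ₛ X → y ∈ₛ es H →
                              ¬ Connects (del X x) y → IsSpanningTree H X*
    IsSpanningTree-exchange (X⊆H , conn , acyc) x∈X y∈H y-separated = X*⊆H , conn* , acyc*
      where
      X*⊆H : X* ⊆ₛ es H
      X*⊆H h h∈X* with h ≟ y
      ... | yes refl = y∈H
      ... | no h≢y   = X⊆H h (no-others h h∈X* h≢y)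

      X*-connects : ∀ g → g ∈ₛ X → Connects X* g
      X*-connects g g∈X with g ≟ x
      ... | yes refl = Connects-exchange y x X-connects-y y-separated Exchanged-⊇ added
        where
        X-connects-y : Connects X y
        X-connects-y = conn _ _ (proj₁ (closed y y∈H)) (proj₂ (closed y y∈H))
      ... | no g≢x   = Reach-edge g (kept g g∈X g≢x)

      conn* : ∀ u w → u ∈ₛ vs H → w ∈ₛ vs H → Reach X* u w
      conn* u w u∈H w∈H = Reach-map X*-connects (conn u w u∈H w∈H)

      acyc* : ∀ g → g ∈ₛ X* → ¬ Connects (del X* g) g
      acyc* g g∈X* W with g ≟ y
      ... | yes refl = y-separated (Reach-mono Exchanged-del-⊆ W)
      ... | no g≢y   =
        y-separated (Connects-exchange g y W g-separated X*-g-y⊆X-x (∈-del⁺ {X} g∈X g≢x))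
        where
        g∈X : g ∈ₛ X
        g∈X = no-others g g∈X* g≢y
        g≢x : g ≢ x
        g≢x refl = removed g∈X*
        X*-g-y⊆X-g : del (del X* g) y ⊆ₛ del X g
        X*-g-y⊆X-g h p = let (q , h≢y) = ∈-del⁻ {del X* g} p ; (h∈X* , h≢g) = ∈-del⁻ {X*} q in
          ∈-del⁺ {X} (no-others h h∈X* h≢y) h≢g
        X*-g-y⊆X-x : del (del X* g) y ⊆ₛ del X x
        X*-g-y⊆X-x h p = let (q , h≢y) = ∈-del⁻ {del X* g} p in
          Exchanged-del-⊆ h (∈-del⁺ {X*} (proj₁ (∈-del⁻ {X*} q)) h≢y)
        g-separated : ¬ Connects (del (del X* g) y) g
        g-separated r = acyc g g∈X (Reach-mono X*-g-y⊆X-g r)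

  module _ {P Q x y} (tp : IsTreePair H P Q) (x∈P : x ∈ₛ P) (y∈Q : y ∈ₛ Q) (ex : Exch H P Q x y) where
    private
      treeP = proj₁ tp
      treeQ = proj₁ (proj₂ tp)
      disjoint = proj₁ (proj₂ (proj₂ tp))
      cover = proj₂ (proj₂ (proj₂ tp))
      acyclicP = proj₂ (proj₂ treeP)
      acyclicQ = proj₂ (proj₂ treeQ)

      y∉P : ¬ y ∈ₛ P
      y∉P y∈P = disjoint y y∈P y∈Q

      y-separated : ¬ Connects (del P x) y
      y-separated = proj₂ (proj₁ (Equivalence.from (ex y) (inj₂ refl)))

      x-separated : ¬ Connects (del Q y) x
      x-separated with proj₂ (Equivalence.from (ex y) (inj₂ refl))
      ... | inj₁ refl            = ⊥-elim (y∉P x∈P)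
      ... | inj₂ (_ , separated) = separated

    module _ {P* Q*} (exP : Exchanged P x y P*) (exQ : Exchanged Q y x Q*) where
      private
        module ExP = Exchanged exP
        module ExQ = Exchanged exQ

      IsTreePair-exchange : IsTreePair H P* Q*
      IsTreePair-exchange =
        IsSpanningTree-exchange exP treeP x∈P (proj₁ treeQ y y∈Q) y-separated ,
        IsSpanningTree-exchange exQ treeQ y∈Q (proj₁ treeP x x∈P) x-separated ,
        disjoint* , cover*
        where
        disjoint* : ∀ e → e ∈ₛ P* → e ∈ₛ Q* → ⊥
        disjoint* e e∈P* e∈Q* with e ≟ x | e ≟ y
        ... | yes refl | _        = ExP.removed e∈P*
        ... | no _     | yes refl = ExQ.removed e∈Q*
        ... | no e≢x   | no e≢y   = disjoint e (ExP.no-others e e∈P* e≢y) (ExQ.no-others e e∈Q* e≢x)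

        cover* : ∀ e → e ∈ₛ es H → (P* e ∨ Q* e) ≡ true
        cover* e e∈H with e ≟ x | e ≟ y
        ... | yes refl | _        = ∨-introʳ {P* x} ExQ.added
        ... | no _     | yes refl = ∨-introˡ ExP.added
        ... | no e≢x   | no e≢y   =
          [ (λ e∈P → ∨-introˡ (ExP.kept e e∈P e≢x))
          , (λ e∈Q → ∨-introʳ {P* e} (ExQ.kept e e∈Q e≢y)) ]′ (∨-elim (P e) (cover e e∈H))

      Exch-reverse : Exch H P* Q* y x
      Exch-reverse g = mk⇔ to from
        where
        to : InD H P* y g × InC Q* y g → g ≡ y ⊎ g ≡ x
        to (_ , inj₁ g≡y) = inj₁ g≡y
        to ((g∈H , g-separated) , inj₂ (g∈Q* , y-separated*)) with g ≟ x
        ... | yes g≡x = inj₂ g≡x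
        ... | no g≢x  =
          swap (Equivalence.to (ex g) ((g∈H , g-separated′) , inj₂ (g∈Q , x-separated′)))
          where
          g∈Q : g ∈ₛ Q
          g∈Q = ExQ.no-others g g∈Q* g≢x
          g-separated′ : ¬ Connects (del P x) g
          g-separated′ r = g-separated (Reach-mono (Exchanged-del-⊇ exP y∉P) r)
          Q-g-y⊆Q-y : del (del Q g) y ⊆ₛ del Q y
          Q-g-y⊆Q-y h p = let (q , h≢y) = ∈-del⁻ {del Q g} p in
            ∈-del⁺ {Q} (proj₁ (∈-del⁻ {Q} q)) h≢y
          Q-g-y⊆Q*-g : del (del Q g) y ⊆ₛ del Q* g
          Q-g-y⊆Q*-g h p = let (q , h≢y) = ∈-del⁻ {del Q g} p ; (h∈Q , h≢g) = ∈-del⁻ {Q} q in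
            ∈-del⁺ {Q*} (ExQ.kept h h∈Q h≢y) h≢g
          x-separated′ : ¬ Connects (del Q g) x
          x-separated′ W = y-separated* (Connects-exchange x y W
            (λ r → x-separated (Reach-mono Q-g-y⊆Q-y r)) Q-g-y⊆Q*-g
            (∈-del⁺ {Q*} ExQ.added (≢-sym g≢x)))

        from : g ≡ y ⊎ g ≡ x → InD H P* y g × InC Q* y g
        from (inj₁ refl) =
          (proj₁ treeQ y y∈Q , λ r → y-separated (Reach-mono (Exchanged-del-⊆ exP) r)) , inj₁ refl
        from (inj₂ refl) =
          (proj₁ treeP x x∈P , λ r → acyclicP x x∈P (Reach-mono (Exchanged-del-⊆ exP) r)) ,
          inj₂ (ExQ.added , λ r → acyclicQ y y∈Q (Reach-mono (Exchanged-del-⊆ exQ) r))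

  arc-reverse : ∀ {e f S T} → IsArc H e f S T →
                IsArc H f e (proj₁ (arcHead e f S T)) (proj₂ (arcHead e f S T))
  arc-reverse {e} {f} {S} {T} (tp , inj₁ (e∈S , f∈T , ex)) rewrite e∈S =
    IsTreePair-exchange tp e∈S f∈T ex exS exT ,
    inj₁ (Exchanged.added exS , Exchanged.added exT , Exch-reverse tp e∈S f∈T ex exS exT)
    where
    e≢f : e ≢ f
    e≢f refl = proj₁ (proj₂ (proj₂ tp)) e e∈S f∈T
    exS = add-del-Exchanged {S} e≢f
    exT = del-add-Exchanged {T} e≢f
  arc-reverse {e} {f} {S} {T} (tp , inj₂ (e∈T , f∈S , ex))
    rewrite ¬-not {S e} {true} (λ e∈S → proj₁ (proj₂ (proj₂ tp)) e e∈S e∈T) =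
    IsTreePair-swap (IsTreePair-exchange tp′ e∈T f∈S ex exT exS) ,
    inj₂ (Exchanged.added exT , Exchanged.added exS , Exch-reverse tp′ e∈T f∈S ex exT exS)
    where
    tp′ = IsTreePair-swap tp
    e≢f : e ≢ f
    e≢f refl = proj₁ (proj₂ (proj₂ tp)) e f∈S e∈T
    exT = add-del-Exchanged {T} e≢f
    exS = del-add-Exchanged {S} e≢f

module JoinsProperties {n m : ℕ} (ends : Fin m → Fin n × Fin n) where
  open Ambient _≟F_ ends
  open ReachProperties _≟F_ ends

  Joins-≢ : ∀ {e u w} → Loopless ends → Joins ends e u w → u ≢ w
  Joins-≢ {e} loopless (inj₁ eq) refl = loopless e (trans (cong proj₁ eq) (sym (cong proj₂ eq)))
  Joins-≢ {e} loopless (inj₂ eq) refl = loopless e (trans (cong proj₁ eq) (sym (cong proj₂ eq)))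

  Joins-Reach : ∀ {F g u w} → Joins ends g u w → Connects F g → Reach F u w
  Joins-Reach {F} (inj₁ eq) r = subst₂ (Reach F) (cong proj₁ eq) (cong proj₂ eq) r
  Joins-Reach {F} (inj₂ eq) r = Reach-sym (subst₂ (Reach F) (cong proj₁ eq) (cong proj₂ eq) r)

  Reach-Joins : ∀ {F g u w} → Joins ends g u w → Reach F u w → Connects F g
  Reach-Joins {F} (inj₁ eq) r = subst₂ (Reach F) (sym (cong proj₁ eq)) (sym (cong proj₂ eq)) r
  Reach-Joins {F} (inj₂ eq) r =
    subst₂ (Reach F) (sym (cong proj₁ eq)) (sym (cong proj₂ eq)) (Reach-sym r)

module DegreeThree
  {n m : ℕ} (ends : Fin m → Fin n × Fin n) (loopless : Loopless ends)
  (v a b c : Fin n) (ea eb ec : Fin m) (eb≢ec : eb ≢ ec) (ea≢ec : ea ≢ ec)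
  (ja : Joins ends ea v a) (jb : Joins ends eb v b) (jc : Joins ends ec v c)
  (spokes : ∀ e → proj₁ (ends e) ≡ v ⊎ proj₂ (ends e) ≡ v → e ≡ ea ⊎ e ≡ eb ⊎ e ≡ ec) where

  module G = Ambient _≟F_ ends
  module Gab = Ambient _≟AB_ (endsAB ends a b)
  module RG = ReachProperties _≟F_ ends
  module RGab = ReachProperties _≟AB_ (endsAB ends a b)
  open JoinsProperties ends

  Hab : Sub n (EdAB m)
  Hab = G-ab v ea eb ec

  a≢v : a ≢ v
  a≢v = ≢-sym (Joins-≢ loopless ja)

  b≢v : b ≢ v
  b≢v = ≢-sym (Joins-≢ loopless jb)

  c≢v : c ≢ v
  c≢v = ≢-sym (Joins-≢ loopless jc)

  AwayFromV : Fin m → Set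
  AwayFromV e = e ≢ ea × e ≢ eb × e ≢ ec

  AwayFromV-ends : ∀ {e} → AwayFromV e → proj₁ (ends e) ≢ v × proj₂ (ends e) ≢ v
  AwayFromV-ends {e} (≢ea , ≢eb , ≢ec) =
    (λ p → not-spoke (spokes e (inj₁ p))) , (λ p → not-spoke (spokes e (inj₂ p)))
    where
    not-spoke : ¬ (e ≡ ea ⊎ e ≡ eb ⊎ e ≡ ec)
    not-spoke = [ ≢ea , [ ≢eb , ≢ec ]′ ]′

  ∈G-ab⇒AwayFromV : ∀ {e} → inj₁ e ∈ₛ es Hab → AwayFromV e
  ∈G-ab⇒AwayFromV {e} p with e ≟F ea | e ≟F eb | e ≟F ec
  ∈G-ab⇒AwayFromV p  | no ≢ea | no ≢eb | no ≢ec = ≢ea , ≢eb , ≢ec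
  ∈G-ab⇒AwayFromV () | yes _  | _      | _
  ∈G-ab⇒AwayFromV () | no _   | yes _  | _
  ∈G-ab⇒AwayFromV () | no _   | no _   | yes _

  AwayFromV⇒∈G-ab : ∀ {e} → AwayFromV e → inj₁ e ∈ₛ es Hab
  AwayFromV⇒∈G-ab {e} (≢ea , ≢eb , ≢ec)
    rewrite ⌊⌋-no (e ≟F ea) ≢ea | ⌊⌋-no (e ≟F eb) ≢eb | ⌊⌋-no (e ≟F ec) ≢ec = refl

  ∈vs-G-ab : ∀ {u} → u ≢ v → u ∈ₛ vs Hab
  ∈vs-G-ab {u} u≢v rewrite ⌊⌋-no (u ≟F v) u≢v = refl

  sendTo : Fin n → Fin n → Fin n
  sendTo t u = if ⌊ u ≟F v ⌋ then t else u

  sendTo-v : ∀ t → sendTo t v ≡ t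
  sendTo-v t rewrite ⌊⌋-yes (v ≟F v) refl = refl

  sendTo-≢v : ∀ t {u} → u ≢ v → sendTo t u ≡ u
  sendTo-≢v t {u} u≢v rewrite ⌊⌋-no (u ≟F v) u≢v = refl

  sendTo-spoke : ∀ {F t p} → p ≢ v → Gab.Reach F (sendTo t v) (sendTo t p) → Gab.Reach F t p
  sendTo-spoke {F} {t} p≢v = subst₂ (Gab.Reach F) (sendTo-v t) (sendTo-≢v t p≢v)

  sendTo-away : ∀ t {e} → AwayFromV e →
    sendTo t (proj₁ (ends e)) ≡ proj₁ (ends e) × sendTo t (proj₂ (ends e)) ≡ proj₂ (ends e)
  sendTo-away t away = sendTo-≢v t (proj₁ (AwayFromV-ends away)) , sendTo-≢v t (proj₂ (AwayFromV-ends away))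

  unsendTo-away : ∀ {F t e} → AwayFromV e →
    Gab.Reach F (sendTo t (proj₁ (ends e))) (sendTo t (proj₂ (ends e))) → RGab.Connects F (inj₁ e)
  unsendTo-away {F} {t} away = let (fix₁ , fix₂) = sendTo-away t away in subst₂ (Gab.Reach F) fix₁ fix₂

  collapse : ∀ t {F F′ u w} →
    (ea ∈ₛ F → Gab.Reach F′ t a) → (eb ∈ₛ F → Gab.Reach F′ t b) → (ec ∈ₛ F → Gab.Reach F′ t c) →
    (∀ e → e ∈ₛ F → AwayFromV e → inj₁ e ∈ₛ F′) →
    G.Reach F u w → Gab.Reach F′ (sendTo t u) (sendTo t w)
  collapse t {F} {F′} via-a via-b via-c away =
    RGab.Reach-image {_≟₀_ = _≟F_} {ends} (sendTo t) edge-image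
    where
    spoke-image : ∀ {e p} → Joins ends e v p → p ≢ v → Gab.Reach F′ t p →
                  Gab.Reach F′ (sendTo t (proj₁ (ends e))) (sendTo t (proj₂ (ends e)))
    spoke-image (inj₁ eq) p≢v r rewrite eq | sendTo-v t | sendTo-≢v t p≢v = r
    spoke-image (inj₂ eq) p≢v r rewrite eq | sendTo-v t | sendTo-≢v t p≢v = RGab.Reach-sym r

    edge-image : ∀ g → g ∈ₛ F → Gab.Reach F′ (sendTo t (proj₁ (ends g))) (sendTo t (proj₂ (ends g)))
    edge-image g g∈F with g ≟F ea | g ≟F eb | g ≟F ec
    ... | yes refl | _        | _        = spoke-image ja a≢v (via-a g∈F)
    ... | no _     | yes refl | _        = spoke-image jb b≢v (via-b g∈F)
    ... | no _     | no _     | yes refl = spoke-image jc c≢v (via-c g∈F)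
    ... | no ≢ea   | no ≢eb   | no ≢ec   =
      let (fix₁ , fix₂) = sendTo-away t (≢ea , ≢eb , ≢ec) in
      subst₂ (Gab.Reach F′) (sym fix₁) (sym fix₂)
        (RGab.Reach-edge (inj₁ g) (away g g∈F (≢ea , ≢eb , ≢ec)))

  lift : ∀ {F F′ u w} → (∀ e → inj₁ e ∈ₛ F → e ∈ₛ F′) → (eab ∈ₛ F → G.Reach F′ a b) →
         Gab.Reach F u w → G.Reach F′ u w
  lift {F} {F′} old new =
    RG.Reach-image {_≟₀_ = _≟AB_} {endsAB ends a b} (λ u → u) edge-image
    where
    edge-image : ∀ g → g ∈ₛ F → G.Reach F′ (proj₁ (endsAB ends a b g)) (proj₂ (endsAB ends a b g))
    edge-image (inj₁ e) e∈F   = RG.Reach-edge e (old e e∈F)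
    edge-image (inj₂ _) eab∈F = new eab∈F

  spokes-Reach : ∀ {F} → ea ∈ₛ F → eb ∈ₛ F → G.Reach F a b
  spokes-Reach ea∈F eb∈F =
    RG.Reach-trans (RG.Reach-sym (Joins-Reach ja (RG.Reach-edge ea ea∈F)))
                   (Joins-Reach jb (RG.Reach-edge eb eb∈F))

  extend : (EdAB m → Bool) → Fin m → Bool
  extend P e = P (inj₁ e) ∨ ⌊ e ≟F ec ⌋

  subdivide : (EdAB m → Bool) → Fin m → Bool
  subdivide Q e = Q (inj₁ e) ∨ ⌊ e ≟F ea ⌋ ∨ ⌊ e ≟F eb ⌋

  ρ-eab∈T : ∀ {S T} → S eab ≡ false → ρ ea eb ec S T ≡ (extend S , subdivide T)
  ρ-eab∈T eab∉S rewrite eab∉S = refl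

  ρ-eab∈S : ∀ {S T} → S eab ≡ true → ρ ea eb ec S T ≡ (subdivide S , extend T)
  ρ-eab∈S eab∈S rewrite eab∈S = refl

  module Extend (P : EdAB m → Bool) (treeP : Gab.IsSpanningTree Hab P) (eab∉P : ¬ eab ∈ₛ P) where
    P-away : ∀ {e} → inj₁ e ∈ₛ P → AwayFromV e
    P-away e∈P = ∈G-ab⇒AwayFromV (proj₁ treeP (inj₁ _) e∈P)

    ec∈extend : ec ∈ₛ extend P
    ec∈extend = ∨-introʳ {P (inj₁ ec)} (⌊⌋-yes (ec ≟F ec) refl)

    extend⁻ : ∀ {e} → e ∈ₛ extend P → inj₁ e ∈ₛ P ⊎ e ≡ ec
    extend⁻ {e} p = [ inj₁ , (λ q → inj₂ (⌊⌋-yes⁻¹ (e ≟F ec) q)) ]′ (∨-elim (P (inj₁ e)) p)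

    extend-old : ∀ {e} → e ∈ₛ extend P → e ≢ ec → inj₁ e ∈ₛ P
    extend-old p e≢ec = [ (λ e∈P → e∈P) , (λ e≡ec → ⊥-elim (e≢ec e≡ec)) ]′ (extend⁻ p)

    lift-extend : ∀ {g u w} → Gab.Reach (Gab.del P (inj₁ g)) u w → G.Reach (G.del (extend P) g) u w
    lift-extend {g} = lift
      (λ e p → let (e∈P , e≢g) = RGab.∈-del⁻ {P} p in
        RG.∈-del⁺ {extend P} (∨-introˡ e∈P) (λ { refl → e≢g refl }))
      (λ p → ⊥-elim (eab∉P (proj₁ (RGab.∈-del⁻ {P} {inj₁ g} p))))

    collapse-extend : ∀ g {u w} → G.Reach (G.del (extend P) g) u w →
                      Gab.Reach (Gab.del P (inj₁ g)) (sendTo c u) (sendTo c w)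
    collapse-extend g = collapse c
      (λ p → ⊥-elim (proj₁ (P-away (extend-old (old p) ea≢ec)) refl))
      (λ p → ⊥-elim (proj₁ (proj₂ (P-away (extend-old (old p) eb≢ec))) refl))
      (λ _ → Gab.here)
      (λ e p (_ , _ , e≢ec) → let (e∈P′ , e≢g) = RG.∈-del⁻ {extend P} p in
        RGab.∈-del⁺ {P} (extend-old e∈P′ e≢ec) (λ { refl → e≢g refl }))
      where
      old : ∀ {e} → e ∈ₛ G.del (extend P) g → e ∈ₛ extend P
      old p = proj₁ (RG.∈-del⁻ {extend P} p)

    extend-connected : ∀ u w → G.Reach (extend P) u w
    extend-connected u w = RG.Reach-trans (to-c u) (RG.Reach-sym (to-c w))
      where
      to-c : ∀ u → G.Reach (extend P) u c
      to-c u with u ≟F v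
      ... | yes refl = Joins-Reach jc (RG.Reach-edge ec ec∈extend)
      ... | no u≢v   = lift (λ _ → ∨-introˡ) (λ p → ⊥-elim (eab∉P p))
                            (proj₁ (proj₂ treeP) u c (∈vs-G-ab u≢v) (∈vs-G-ab c≢v))

    -- Removing ec from extend P leaves v isolated, so ec is a bridge.
    extend-acyclic : ∀ g → g ∈ₛ extend P → ¬ RG.Connects (G.del (extend P) g) g
    extend-acyclic g p W with extend⁻ p
    ... | inj₁ g∈P =
      proj₂ (proj₂ treeP) (inj₁ g) g∈P (unsendTo-away (P-away g∈P) (collapse-extend g W))
    ... | inj₂ refl = c≢v (RG.Reach-isolated away-from-v (RG.Reach-sym (Joins-Reach jc W)))
      where
      away-from-v : ∀ e → e ∈ₛ G.del (extend P) ec → proj₁ (ends e) ≢ v × proj₂ (ends e) ≢ v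
      away-from-v e q = let (e∈P′ , e≢ec) = RG.∈-del⁻ {extend P} q in
        AwayFromV-ends (P-away (extend-old e∈P′ e≢ec))

    extend-spanning : G.IsSpanningTree full (extend P)
    extend-spanning = (λ _ _ → refl) , (λ u w _ _ → extend-connected u w) , extend-acyclic

  module Subdivide (Q : EdAB m → Bool) (treeQ : Gab.IsSpanningTree Hab Q) (eab∈Q : eab ∈ₛ Q) where
    private
      acyclicQ = proj₂ (proj₂ treeQ)

    Q-away : ∀ {e} → inj₁ e ∈ₛ Q → AwayFromV e
    Q-away e∈Q = ∈G-ab⇒AwayFromV (proj₁ treeQ (inj₁ _) e∈Q)

    ea∈subdivide : ea ∈ₛ subdivide Q
    ea∈subdivide = ∨-introʳ {Q (inj₁ ea)} (∨-introˡ (⌊⌋-yes (ea ≟F ea) refl))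

    eb∈subdivide : eb ∈ₛ subdivide Q
    eb∈subdivide = ∨-introʳ {Q (inj₁ eb)} (∨-introʳ {⌊ eb ≟F ea ⌋} (⌊⌋-yes (eb ≟F eb) refl))

    subdivide⁻ : ∀ {e} → e ∈ₛ subdivide Q → inj₁ e ∈ₛ Q ⊎ e ≡ ea ⊎ e ≡ eb
    subdivide⁻ {e} p with ∨-elim (Q (inj₁ e)) p
    ... | inj₁ e∈Q = inj₁ e∈Q
    ... | inj₂ q with ∨-elim ⌊ e ≟F ea ⌋ q
    ...   | inj₁ r = inj₂ (inj₁ (⌊⌋-yes⁻¹ (e ≟F ea) r))
    ...   | inj₂ r = inj₂ (inj₂ (⌊⌋-yes⁻¹ (e ≟F eb) r))

    ec∉subdivide : ¬ ec ∈ₛ subdivide Q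
    ec∉subdivide p =
      [ (λ ec∈Q → proj₂ (proj₂ (Q-away ec∈Q)) refl)
      , [ (λ ec≡ea → ea≢ec (sym ec≡ea)) , (λ ec≡eb → eb≢ec (sym ec≡eb)) ]′ ]′ (subdivide⁻ p)

    subdivide-del-old : ∀ {g e} → e ∈ₛ G.del (subdivide Q) g → AwayFromV e → inj₁ e ∈ₛ Q × e ≢ g
    subdivide-del-old p (e≢ea , e≢eb , _) with RG.∈-del⁻ {subdivide Q} p
    ... | e∈Q′ , e≢g =
      [ (λ e∈Q → e∈Q) , [ (λ e≡ea → ⊥-elim (e≢ea e≡ea)) , (λ e≡eb → ⊥-elim (e≢eb e≡eb)) ]′ ]′
        (subdivide⁻ e∈Q′) , e≢g

    lift-subdivide : ∀ {g u w} → inj₁ g ∈ₛ Q →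
                     Gab.Reach (Gab.del Q (inj₁ g)) u w → G.Reach (G.del (subdivide Q) g) u w
    lift-subdivide {g} g∈Q = lift
      (λ e p → let (e∈Q , e≢g) = RGab.∈-del⁻ {Q} p in
        RG.∈-del⁺ {subdivide Q} (∨-introˡ e∈Q) (λ { refl → e≢g refl }))
      (λ _ → spokes-Reach
        (RG.∈-del⁺ {subdivide Q} ea∈subdivide (λ { refl → proj₁ (Q-away g∈Q) refl }))
        (RG.∈-del⁺ {subdivide Q} eb∈subdivide (λ { refl → proj₁ (proj₂ (Q-away g∈Q)) refl })))

    -- Once a spoke at v is deleted, v hangs off the other spoke: contract it onto that neighbour.
    collapse-without-ea : ∀ {u w} → G.Reach (G.del (subdivide Q) ea) u w →
                          Gab.Reach (Gab.del Q eab) (sendTo b u) (sendTo b w)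
    collapse-without-ea = collapse b
      (λ p → ⊥-elim (proj₂ (RG.∈-del⁻ {subdivide Q} p) refl)) (λ _ → Gab.here)
      (λ p → ⊥-elim (ec∉subdivide (proj₁ (RG.∈-del⁻ {subdivide Q} p))))
      (λ e p away → RGab.∈-del⁺ {Q} {eab} (proj₁ (subdivide-del-old p away)) λ ())

    collapse-without-eb : ∀ {u w} → G.Reach (G.del (subdivide Q) eb) u w →
                          Gab.Reach (Gab.del Q eab) (sendTo a u) (sendTo a w)
    collapse-without-eb = collapse a
      (λ _ → Gab.here) (λ p → ⊥-elim (proj₂ (RG.∈-del⁻ {subdivide Q} p) refl))
      (λ p → ⊥-elim (ec∉subdivide (proj₁ (RG.∈-del⁻ {subdivide Q} p))))
      (λ e p away → RGab.∈-del⁺ {Q} {eab} (proj₁ (subdivide-del-old p away)) λ ())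

    collapse-without : ∀ g {u w} → G.Reach (G.del (subdivide Q) g) u w →
                       Gab.Reach (Gab.del Q (inj₁ g)) (sendTo a u) (sendTo a w)
    collapse-without g = collapse a
      (λ _ → Gab.here) (λ _ → RGab.Reach-edge eab (RGab.∈-del⁺ {Q} {inj₁ g} eab∈Q λ ()))
      (λ p → ⊥-elim (ec∉subdivide (proj₁ (RG.∈-del⁻ {subdivide Q} p))))
      (λ e p away → let (e∈Q , e≢g) = subdivide-del-old p away in
        RGab.∈-del⁺ {Q} e∈Q (λ { refl → e≢g refl }))

    subdivide-connected : ∀ u w → G.Reach (subdivide Q) u w
    subdivide-connected u w = RG.Reach-trans (to-a u) (RG.Reach-sym (to-a w))
      where
      to-a : ∀ u → G.Reach (subdivide Q) u a
      to-a u with u ≟F v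
      ... | yes refl = Joins-Reach ja (RG.Reach-edge ea ea∈subdivide)
      ... | no u≢v   = lift (λ _ → ∨-introˡ) (λ _ → spokes-Reach ea∈subdivide eb∈subdivide)
                            (proj₁ (proj₂ treeQ) u a (∈vs-G-ab u≢v) (∈vs-G-ab a≢v))

    subdivide-acyclic : ∀ g → g ∈ₛ subdivide Q → ¬ RG.Connects (G.del (subdivide Q) g) g
    subdivide-acyclic g p W with subdivide⁻ p
    ... | inj₁ g∈Q         = acyclicQ (inj₁ g) g∈Q (unsendTo-away (Q-away g∈Q) (collapse-without g W))
    ... | inj₂ (inj₁ refl) = acyclicQ eab eab∈Q
                               (RGab.Reach-sym (sendTo-spoke a≢v (collapse-without-ea (Joins-Reach ja W))))
    ... | inj₂ (inj₂ refl) = acyclicQ eab eab∈Q (sendTo-spoke b≢v (collapse-without-eb (Joins-Reach jb W)))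

    subdivide-spanning : G.IsSpanningTree full (subdivide Q)
    subdivide-spanning = (λ _ _ → refl) , (λ u w _ _ → subdivide-connected u w) , subdivide-acyclic

  module _ {P Q : EdAB m → Bool} (tp : Gab.IsTreePair Hab P Q) (eab∈Q : eab ∈ₛ Q) where
    private
      treeP = proj₁ tp
      treeQ = proj₁ (proj₂ tp)
      disjoint = proj₁ (proj₂ (proj₂ tp))
      cover = proj₂ (proj₂ (proj₂ tp))
      eab∉P : ¬ eab ∈ₛ P
      eab∉P eab∈P = disjoint eab eab∈P eab∈Q
    open Extend P treeP eab∉P
    open Subdivide Q treeQ eab∈Q

    extend-subdivide-treePair : G.IsTreePair full (extend P) (subdivide Q)
    extend-subdivide-treePair = extend-spanning , subdivide-spanning , disjoint′ , cover′
      where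
      disjoint′ : ∀ e → e ∈ₛ extend P → e ∈ₛ subdivide Q → ⊥
      disjoint′ e p q with extend⁻ p | subdivide⁻ q
      ... | inj₂ refl | _                = ec∉subdivide q
      ... | inj₁ e∈P  | inj₁ e∈Q         = disjoint (inj₁ e) e∈P e∈Q
      ... | inj₁ e∈P  | inj₂ (inj₁ refl) = proj₁ (P-away e∈P) refl
      ... | inj₁ e∈P  | inj₂ (inj₂ refl) = proj₁ (proj₂ (P-away e∈P)) refl

      cover′ : ∀ e → e ∈ₛ es (full {n}) → (extend P e ∨ subdivide Q e) ≡ true
      cover′ e _ = by-cases (e ≟F ea) (e ≟F eb) (e ≟F ec)
        where
        by-cases : Dec (e ≡ ea) → Dec (e ≡ eb) → Dec (e ≡ ec) → (extend P e ∨ subdivide Q e) ≡ true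
        by-cases (yes refl) _          _          = ∨-introʳ {extend P ea} ea∈subdivide
        by-cases (no _)     (yes refl) _          = ∨-introʳ {extend P eb} eb∈subdivide
        by-cases (no _)     (no _)     (yes refl) = ∨-introˡ ec∈extend
        by-cases (no ≢ea)   (no ≢eb)   (no ≢ec)   =
          [ (λ e∈P → ∨-introˡ (∨-introˡ e∈P)) , (λ e∈Q → ∨-introʳ {extend P e} (∨-introˡ e∈Q)) ]′
            (∨-elim (P (inj₁ e)) (cover (inj₁ e) (AwayFromV⇒∈G-ab (≢ea , ≢eb , ≢ec))))

    module _ {f : Fin m} (f∈P : inj₁ f ∈ₛ P) (ex : Gab.Exch Hab P Q (inj₁ f) eab) where
      private
        P-f : EdAB m → Bool
        P-f = Gab.del P (inj₁ f)

        f-away : AwayFromV f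
        f-away = P-away f∈P

        a-b-separated : ¬ Gab.Reach P-f a b
        a-b-separated = proj₂ (proj₁ (Equivalence.from (ex eab) (inj₂ refl)))

        f-separated : ¬ RGab.Connects (Gab.del Q eab) (inj₁ f)
        f-separated with proj₂ (Equivalence.from (ex eab) (inj₂ refl))
        ... | inj₂ (_ , separated) = separated

        v-c : G.Reach (G.del (extend P) f) v c
        v-c = Joins-Reach jc
          (RG.Reach-edge ec (RG.∈-del⁺ {extend P} ec∈extend (≢-sym (proj₂ (proj₂ f-away)))))

        side : ∀ u → u ≢ v → Gab.Reach P-f u (proj₁ (ends f)) ⊎ Gab.Reach P-f u (proj₂ (ends f))
        side u u≢v = RGab.Reach-del-side {P} (inj₁ f)
          (proj₁ (proj₂ treeP) _ u (∈vs-G-ab (proj₁ (AwayFromV-ends f-away))) (∈vs-G-ab u≢v))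

        -- P - f has the two components of the ends of f, and a and b lie in different ones.
        c-side : Gab.Reach P-f c b ⊎ Gab.Reach P-f c a
        c-side with side a a≢v | side b b≢v | side c c≢v
        ... | inj₁ a~ | inj₁ b~ | _      = ⊥-elim (a-b-separated (RGab.Reach-trans a~ (RGab.Reach-sym b~)))
        ... | inj₂ a~ | inj₂ b~ | _      = ⊥-elim (a-b-separated (RGab.Reach-trans a~ (RGab.Reach-sym b~)))
        ... | inj₁ a~ | inj₂ _  | inj₁ c~ = inj₂ (RGab.Reach-trans c~ (RGab.Reach-sym a~))
        ... | inj₁ _  | inj₂ b~ | inj₂ c~ = inj₁ (RGab.Reach-trans c~ (RGab.Reach-sym b~))
        ... | inj₂ _  | inj₁ b~ | inj₁ c~ = inj₁ (RGab.Reach-trans c~ (RGab.Reach-sym b~))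
        ... | inj₂ a~ | inj₁ _  | inj₂ c~ = inj₂ (RGab.Reach-trans c~ (RGab.Reach-sym a~))

      -- The choices e₂ = ea and e₂ = eb are symmetric: in both, c lies with q and not with p in P - f.
      module Partner {e₂ eo : Fin m} {p q : Fin n}
        (j₂ : Joins ends e₂ v p) (jo : Joins ends eo v q) (p≢v : p ≢ v)
        (spokes-ab : ∀ {g} → g ≡ ea ⊎ g ≡ eb → g ≡ e₂ ⊎ g ≡ eo) (e₂∈Q′ : e₂ ∈ₛ subdivide Q)
        (collapse-without-e₂ : ∀ {u w} → G.Reach (G.del (subdivide Q) e₂) u w →
                               Gab.Reach (Gab.del Q eab) (sendTo q u) (sendTo q w))
        (c~q : Gab.Reach P-f c q) (p≁q : ¬ Gab.Reach P-f p q) where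

        e₂-separated : ¬ RG.Connects (G.del (extend P) f) e₂
        e₂-separated W = p≁q (RGab.Reach-trans (RGab.Reach-sym c~p) c~q)
          where
          c~p : Gab.Reach P-f c p
          c~p = sendTo-spoke p≢v (collapse-extend f (Joins-Reach j₂ W))

        f-separated′ : ¬ RG.Connects (G.del (subdivide Q) e₂) f
        f-separated′ W = f-separated (unsendTo-away f-away (collapse-without-e₂ W))

        eo-connected : RG.Connects (G.del (extend P) f) eo
        eo-connected = Reach-Joins jo (RG.Reach-trans v-c (lift-extend c~q))

        exch : G.Exch full (extend P) (subdivide Q) f e₂
        exch g = mk⇔ to from
          where
          to : G.InD full (extend P) f g × G.InC (subdivide Q) f g → g ≡ f ⊎ g ≡ e₂
          to (_ , inj₁ g≡f) = inj₁ g≡f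
          to ((_ , g-separated) , inj₂ (g∈Q′ , f-separated-g)) with subdivide⁻ g∈Q′
          ... | inj₂ g-spoke =
            [ inj₂ , (λ { refl → ⊥-elim (g-separated eo-connected) }) ]′ (spokes-ab g-spoke)
          ... | inj₁ g∈Q = [ (λ { refl → inj₁ refl }) , (λ ()) ]′
            (Equivalence.to (ex (inj₁ g))
              ( (proj₁ treeQ (inj₁ g) g∈Q , λ r → g-separated (lift-extend r))
              , inj₂ (g∈Q , λ r → f-separated-g (lift-subdivide g∈Q r))))

          from : g ≡ f ⊎ g ≡ e₂ → G.InD full (extend P) f g × G.InC (subdivide Q) f g
          from (inj₁ refl) = (refl , extend-acyclic f (∨-introˡ f∈P)) , inj₁ refl
          from (inj₂ refl) = (refl , e₂-separated) , inj₂ (e₂∈Q′ , f-separated′)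

      exchange-partner : Σ (Fin m) λ e₂ → (e₂ ≡ ea ⊎ e₂ ≡ eb) × e₂ ∈ₛ subdivide Q ×
                                          G.Exch full (extend P) (subdivide Q) f e₂
      exchange-partner with c-side
      ... | inj₁ c~b = ea , inj₁ refl , ea∈subdivide ,
        Partner.exch ja jb a≢v (λ g-spoke → g-spoke) ea∈subdivide collapse-without-ea c~b a-b-separated
      ... | inj₂ c~a = eb , inj₂ refl , eb∈subdivide ,
        Partner.exch jb ja b≢v swap eb∈subdivide collapse-without-eb c~a
          (λ r → a-b-separated (RGab.Reach-sym r))

  ρ-arc : ∀ {f S T} → Gab.IsArc Hab (inj₁ f) eab S T →
    Σ (Fin m) λ e₂ → (e₂ ≡ ea ⊎ e₂ ≡ eb) ×
      G.IsArc full f e₂ (proj₁ (ρ ea eb ec S T)) (proj₂ (ρ ea eb ec S T))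
  ρ-arc {f} {S} {T} (tp , inj₁ (f∈S , eab∈T , ex))
    rewrite ρ-eab∈T {S} {T} (¬-not λ eab∈S → proj₁ (proj₂ (proj₂ tp)) eab eab∈S eab∈T) =
    let (e₂ , e₂-spoke , e₂∈T′ , exch) = exchange-partner tp eab∈T f∈S ex in
    e₂ , e₂-spoke , extend-subdivide-treePair tp eab∈T , inj₁ (∨-introˡ f∈S , e₂∈T′ , exch)
  ρ-arc {f} {S} {T} (tp , inj₂ (f∈T , eab∈S , ex)) rewrite ρ-eab∈S {S} {T} eab∈S =
    let (e₂ , e₂-spoke , e₂∈S′ , exch) = exchange-partner tp′ eab∈S f∈T ex in
    e₂ , e₂-spoke , RG.IsTreePair-swap (extend-subdivide-treePair tp′ eab∈S) ,
    inj₂ (∨-introˡ f∈T , e₂∈S′ , exch)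
    where
    tp′ = RGab.IsTreePair-swap tp

mainTheorem20 : (n m : ℕ) (ends : Fin m → Fin n × Fin n) → Loopless ends →
    Ambient.Bispanning _≟F_ ends full → Ambient.Atomic _≟F_ ends full →
    (v a b c : Fin n) (ea eb ec : Fin m) →
    a ≢ b → b ≢ c → a ≢ c → ea ≢ eb → eb ≢ ec → ea ≢ ec →
    Joins ends ea v a → Joins ends eb v b → Joins ends ec v c →
    (∀ e → proj₁ (ends e) ≡ v ⊎ proj₂ (ends e) ≡ v → e ≡ ea ⊎ e ≡ eb ⊎ e ≡ ec) →
    (f : Fin m) (S T : EdAB m → Bool) →
    Ambient.IsArc _≟AB_ (endsAB ends a b) (G-ab v ea eb ec) (inj₁ f) eab S T →
    Σ (Fin m) λ e₂ → (e₂ ≡ ea ⊎ e₂ ≡ eb) ×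
      Ambient.IsArc _≟F_ ends full f e₂
        (proj₁ (ρ ea eb ec S T)) (proj₂ (ρ ea eb ec S T)) ×
      Ambient.IsArc _≟F_ ends full e₂ f
        (proj₁ (Ambient.arcHead _≟F_ ends f e₂
                 (proj₁ (ρ ea eb ec S T)) (proj₂ (ρ ea eb ec S T))))
        (proj₂ (Ambient.arcHead _≟F_ ends f e₂
                 (proj₁ (ρ ea eb ec S T)) (proj₂ (ρ ea eb ec S T))))
mainTheorem20 n m ends loopless _ _ v a b c ea eb ec _ _ _ _ eb≢ec ea≢ec ja jb jc spokes f S T arc =
  let (e₂ , e₂-spoke , arc₁) = DegreeThree.ρ-arc ends loopless v a b c ea eb ec eb≢ec ea≢ec ja jb jc spokes arc
  in e₂ , e₂-spoke , arc₁ , TreeExchange.arc-reverse _≟F_ ends full (λ _ _ → refl , refl) arc₁
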